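{- Let $\kappa:\mathbb N\to\mathbb N$ be defined by $$\kappa(n)=\begin{cases}\lfloor\varphi n+1\rfloor,& n\in R_{2,0},\\ \lfloor\varphi n-1\rfloor,& n\in R_{1,0},\\ \lfloor(\varphi-1)n+1\rfloor,& n\in R_{1,1}.\end{cases}$$ Then for every integer $n\geq 1$, $\kappa^n(3)=F(n+3)+2$, where $\kappa^n$ denotes the $n$-fold composition of $\kappa$.
   Context: Let $\varphi=\frac{1+\sqrt5}{2}$ and $\mathbb N=\{1,2,3,\dots\}$; $a(n)=\lfloor n\varphi\rfloor$. $F$ is the Fibonacci sequence, $F(0)=0$, $F(1)=F(2)=1$, $F(n)=F(n-1)+F(n-2)$. For $i\in\mathbb Z^{\geq0}$, $j\in\mathbb Z$, let $f_{i,j}(n)=F(i+1)a(n)+F(i)n-j$ ($n\in\mathbb N$) and $R_{i,j}=\{f_{i,j}(n)\mid n\in\mathbb N\}$; the sets $R_{1,0},R_{1,1},R_{2,0}$ partition $\mathbb N$. -}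

module Defs where

open import Data.Nat using (ℕ; zero; suc; _+_; _*_; _∸_; _≤ᵇ_)
open import Data.Bool using (if_then_else_)
import Data.Nat
import Relation.Binary.PropositionalEquality
open import Data.Integer using (ℤ; +_) renaming (_+_ to _+ℤ_; _*_ to _*ℤ_; _-_ to _-ℤ_)

F : ℕ → ℕ
F zero = 0
F (suc zero) = 1
F (suc (suc n)) = F (suc n) + F n

-- k ≤ n·φ  (φ = (1+√5)/2)  ⟺  2k - n ≤ n√5  ⟺  (2k ∸ n)² ≤ 5n²
-- (if 2k ≤ n then 2k ∸ n = 0 and the test is trivially true, as it should be).
leφ : ℕ → ℕ → ℕ
leφ n k = if ((2 * k ∸ n) * (2 * k ∸ n)) ≤ᵇ (5 * (n * n)) then 1 else 0

countφ : ℕ → ℕ → ℕ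
countφ n zero = 0
countφ n (suc m) = countφ n m + leφ n (suc m)

-- a n = ⌊ n φ ⌋ = #{ k ∈ {1,…,2n} : k ≤ n φ }   (n φ < 2n, so the range suffices)
a : ℕ → ℕ
a n = countφ n (2 * n)

f : ℕ → ℤ → ℕ → ℤ
f i j m = ((+ F (suc i)) *ℤ (+ a m) +ℤ (+ F i) *ℤ (+ m)) -ℤ j

data InR (i : ℕ) (j : ℤ) (n : ℤ) : Set where
  witness : (m : ℕ) → 1 Data.Nat.≤ m → n Relation.Binary.PropositionalEquality.≡ f i j m → InR i j n

iter : (ℕ → ℕ) → ℕ → ℕ → ℕ
iter g zero x = x
iter g (suc n) x = g (iter g n x)

-- With z = F (t + 1) and w = F t, Cassini's identity z² − zw − w² = ±1 pins down ⌊nφ⌋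
-- (decided by comparing (2k − n)² with 5n²) for n = F (t + 2) + 1 and n = F (t + 4) + 2.
-- The first value shows F (t + 4) + 2 = a m + m ∈ R₁,₀ with m = F (t + 2) + 1, so κ sends
-- it to a (F (t + 4) + 2) − 1, which the second value makes F (t + 5) + 2.  The orbit
-- starts at 3 = f₂,₀(1) ∈ R₂,₀, with κ 3 = a 3 + 1 = F 4 + 2.
module Submission where

open import Defs
open import Data.Nat using (ℕ; zero; suc; _+_; _*_; _∸_; _⊓_; _≤_; _<_; z≤n; s≤s; _≤ᵇ_; _≤?_)
open import Data.Nat.Properties
open import Data.Nat.Tactic.RingSolver using (solve-∀)
open import Data.Integer using (+_; _-_) renaming (_+_ to _+ℤ_)
import Data.Integer.Properties as ℤₚ
open import Data.Bool using (true; false)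
open import Data.Unit using (tt)
open import Relation.Nullary using (¬_; yes; no; contradiction)
open import Relation.Binary.PropositionalEquality
  using (_≡_; refl; sym; trans; cong; cong₂; subst; module ≡-Reasoning)

_≤φ·_ : ℕ → ℕ → Set
k ≤φ· n = (2 * k ∸ n) * (2 * k ∸ n) ≤ 5 * (n * n)

leφ-≡1 : ∀ n k → k ≤φ· n → leφ n k ≡ 1
leφ-≡1 n k k≤nφ with (2 * k ∸ n) * (2 * k ∸ n) ≤ᵇ 5 * (n * n) | ≤⇒≤ᵇ k≤nφ
... | true  | _ = refl
... | false | ()

leφ-≡0 : ∀ n k → ¬ k ≤φ· n → leφ n k ≡ 0
leφ-≡0 n k k≰nφ with (2 * k ∸ n) * (2 * k ∸ n) ≤ᵇ 5 * (n * n)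
                     | ≤ᵇ⇒≤ ((2 * k ∸ n) * (2 * k ∸ n)) (5 * (n * n))
... | true  | k≤nφ = contradiction (k≤nφ tt) k≰nφ
... | false | _    = refl

≤φ·-antitone : ∀ n {j k} → j ≤ k → k ≤φ· n → j ≤φ· n
≤φ·-antitone n j≤k = ≤-trans (*-mono-≤ d≤ d≤)
  where d≤ = ∸-monoˡ-≤ n (*-monoʳ-≤ 2 j≤k)

countφ-threshold : ∀ n K → K ≤φ· n → ¬ suc K ≤φ· n → ∀ m → countφ n m ≡ m ⊓ K
countφ-threshold n K inK outK zero = refl
countφ-threshold n K inK outK (suc m) with suc m ≤? K
... | yes m<K = begin
  countφ n m + leφ n (suc m) ≡⟨ cong₂ _+_ (countφ-threshold n K inK outK m)
                                           (leφ-≡1 n (suc m) (≤φ·-antitone n m<K inK)) ⟩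
  m ⊓ K + 1                  ≡⟨ cong (_+ 1) (m≤n⇒m⊓n≡m (<⇒≤ m<K)) ⟩
  m + 1                      ≡⟨ +-comm m 1 ⟩
  suc m                      ≡⟨ sym (m≤n⇒m⊓n≡m m<K) ⟩
  suc m ⊓ K                  ∎
  where open ≡-Reasoning
... | no m≮K = begin
  countφ n m + leφ n (suc m) ≡⟨ cong₂ _+_ (countφ-threshold n K inK outK m)
                                           (leφ-≡0 n (suc m) (λ m≤nφ → outK (≤φ·-antitone n K<m m≤nφ))) ⟩
  m ⊓ K + 0                  ≡⟨ +-identityʳ (m ⊓ K) ⟩
  m ⊓ K                      ≡⟨ m≥n⇒m⊓n≡n (≤-pred K<m) ⟩
  K                          ≡⟨ sym (m≥n⇒m⊓n≡n (<⇒≤ K<m)) ⟩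
  suc m ⊓ K                  ∎
  where
  open ≡-Reasoning
  K<m : K < suc m
  K<m = ≰⇒> m≮K

a-≡ : ∀ n K → K ≤ 2 * n → K ≤φ· n → ¬ suc K ≤φ· n → a n ≡ K
a-≡ n K K≤2n inK outK = trans (countφ-threshold n K inK outK (2 * n)) (m≥n⇒m⊓n≡n K≤2n)

2[i+n]∸n≡2i+n : ∀ i n → 2 * (i + n) ∸ n ≡ 2 * i + n
2[i+n]∸n≡2i+n i n = trans (cong (_∸ n) (double i n)) (m+n∸m≡n n (2 * i + n))
  where
  double : ∀ i n → 2 * (i + n) ≡ n + (2 * i + n)
  double = solve-∀

a-≡-by-squares : ∀ n j → j ≤ n
               → (2 * j + n) * (2 * j + n) ≤ 5 * (n * n)
               → 5 * (n * n) < (2 * j + n + 2) * (2 * j + n + 2)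
               → a n ≡ j + n
a-≡-by-squares n j j≤n lower upper = a-≡ n (j + n) (+-mono-≤ j≤n (m≤m+n n 0)) inK outK
  where
  shift : ∀ j n → 2 * suc j + n ≡ 2 * j + n + 2
  shift = solve-∀
  inK : (j + n) ≤φ· n
  inK = subst (λ d → d * d ≤ 5 * (n * n)) (sym (2[i+n]∸n≡2i+n j n)) lower
  outK : ¬ suc (j + n) ≤φ· n
  outK = subst (λ d → ¬ d * d ≤ 5 * (n * n))
               (sym (trans (2[i+n]∸n≡2i+n (suc j) n) (shift j n))) (<⇒≱ upper)

≤-from-identity : ∀ {x y u v} d → y + u ≡ x + v + d → u ≤ v → x ≤ y
≤-from-identity {x} {y} {u} {v} d eq u≤v = +-cancelʳ-≤ u x y (begin
  x + u     ≤⟨ +-monoʳ-≤ x u≤v ⟩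
  x + v     ≤⟨ m≤m+n (x + v) d ⟩
  x + v + d ≡⟨ sym eq ⟩
  y + u     ∎)
  where open ≤-Reasoning

<-from-identity : ∀ {x y u v} d → y + u ≡ x + v + suc d → u ≤ v → x < y
<-from-identity {x} {v = v} d eq = ≤-from-identity d (trans eq (+-suc (x + v) d))

-- (w , z) behaves like (F t , F (t + 1)): the last two fields say z² − zw − w² ∈ {−1, 0, 1}.
record GoldenPair (w z : ℕ) : Set where
  field
    w≤z   : w ≤ z
    1≤z   : 1 ≤ z
    upper : w * w + z * w ≤ z * z + 1
    lower : z * z ≤ w * w + z * w + 1

goldenPair-step : ∀ {w z} → GoldenPair w z → GoldenPair z (z + w)
goldenPair-step {w} {z} p = record
  { w≤z   = m≤m+n z w
  ; 1≤z   = ≤-trans 1≤z (m≤m+n z w)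
  ; upper = ≤-from-identity 0 (upper′ z w) lower
  ; lower = ≤-from-identity 0 (lower′ z w) upper
  }
  where
  open GoldenPair p
  upper′ : ∀ z w → (z + w) * (z + w) + 1 + z * z ≡ z * z + (z + w) * z + (w * w + z * w + 1) + 0
  upper′ = solve-∀
  lower′ : ∀ z w → z * z + (z + w) * z + 1 + (w * w + z * w) ≡ (z + w) * (z + w) + (z * z + 1) + 0
  lower′ = solve-∀

fib-goldenPair : ∀ t → GoldenPair (F t) (F (suc t))
fib-goldenPair zero    = record { w≤z = z≤n ; 1≤z = ≤-refl ; upper = z≤n ; lower = ≤-refl }
fib-goldenPair (suc t) = goldenPair-step (fib-goldenPair t)

a-goldenPair-+1 : ∀ {w z} → GoldenPair w z → a (z + w + 1) ≡ z + (z + w + 1)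
a-goldenPair-+1 {w} {z} p = a-≡-by-squares (z + w + 1) z (≤-trans (m≤m+n z w) (m≤m+n (z + w) 1))
  (≤-from-identity (4 * z + 8 * w) (lower′ z w) (*-monoʳ-≤ 4 lower))
  (<-from-identity 3 (upper′ z w)
    (+-mono-≤ (+-mono-≤ (*-monoʳ-≤ 4 upper) (*-monoʳ-≤ 4 w≤z)) (*-monoʳ-≤ 4 1≤z)))
  where
  open GoldenPair p
  lower′ : ∀ z w → 5 * ((z + w + 1) * (z + w + 1)) + 4 * (z * z)
                 ≡ (2 * z + (z + w + 1)) * (2 * z + (z + w + 1)) + 4 * (w * w + z * w + 1) + (4 * z + 8 * w)
  lower′ = solve-∀
  upper′ : ∀ z w → (2 * z + (z + w + 1) + 2) * (2 * z + (z + w + 1) + 2) + (4 * (w * w + z * w) + 4 * w + 4 * 1)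
                 ≡ 5 * ((z + w + 1) * (z + w + 1)) + (4 * (z * z + 1) + 4 * z + 4 * z) + 4
  upper′ = solve-∀

a-goldenPair-+2 : ∀ {w z} → GoldenPair w z
                → a (3 * z + 2 * w + 2) ≡ (2 * z + w + 1) + (3 * z + 2 * w + 2)
a-goldenPair-+2 {w} {z} p = a-≡-by-squares (3 * z + 2 * w + 2) (2 * z + w + 1)
  (≤-from-identity (z + w + 1) (j≤n z w) z≤n)
  (≤-from-identity (4 * z + 8 * w) (lower′ z w) (*-monoʳ-≤ 4 lower))
  (<-from-identity (11 + 24 * z + 8 * w) (upper′ z w) (*-monoʳ-≤ 4 upper))
  where
  open GoldenPair p
  j≤n : ∀ z w → 3 * z + 2 * w + 2 + 0 ≡ 2 * z + w + 1 + 0 + (z + w + 1)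
  j≤n = solve-∀
  lower′ : ∀ z w → 5 * ((3 * z + 2 * w + 2) * (3 * z + 2 * w + 2)) + 4 * (z * z)
                 ≡ (2 * (2 * z + w + 1) + (3 * z + 2 * w + 2)) * (2 * (2 * z + w + 1) + (3 * z + 2 * w + 2)) + 4 * (w * w + z * w + 1) + (4 * z + 8 * w)
  lower′ = solve-∀
  upper′ : ∀ z w → (2 * (2 * z + w + 1) + (3 * z + 2 * w + 2) + 2) * (2 * (2 * z + w + 1) + (3 * z + 2 * w + 2) + 2) + 4 * (w * w + z * w)
                 ≡ 5 * ((3 * z + 2 * w + 2) * (3 * z + 2 * w + 2)) + 4 * (z * z + 1) + suc (11 + 24 * z + 8 * w)
  upper′ = solve-∀

a-F+1 : ∀ t → a (F (2 + t) + 1) ≡ F (3 + t) + 1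
a-F+1 t = trans (a-goldenPair-+1 (fib-goldenPair t)) (regroup (F (1 + t)) (F t))
  where
  regroup : ∀ z w → z + (z + w + 1) ≡ z + w + z + 1
  regroup = solve-∀

a-F+2 : ∀ t → a (F (4 + t) + 2) ≡ F (5 + t) + 3
a-F+2 t = begin
  a (F (4 + t) + 2)                     ≡⟨ cong a (argument z w) ⟩
  a (3 * z + 2 * w + 2)                 ≡⟨ a-goldenPair-+2 (fib-goldenPair t) ⟩
  (2 * z + w + 1) + (3 * z + 2 * w + 2) ≡⟨ value z w ⟩
  F (5 + t) + 3                         ∎
  where
  open ≡-Reasoning
  z = F (1 + t)
  w = F t
  argument : ∀ z w → z + w + z + (z + w) + 2 ≡ 3 * z + 2 * w + 2
  argument = solve-∀
  value : ∀ z w → (2 * z + w + 1) + (3 * z + 2 * w + 2) ≡ z + w + z + (z + w) + (z + w + z) + 3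
  value = solve-∀

f₁,₀ : ∀ m → f 1 (+ 0) m ≡ + (a m + m)
f₁,₀ m = trans (ℤₚ.+-identityʳ _) (cong₂ _+ℤ_ (ℤₚ.*-identityˡ (+ a m)) (ℤₚ.*-identityˡ (+ m)))

F+2∈R₁,₀ : ∀ t → InR 1 (+ 0) (+ (F (4 + t) + 2))
F+2∈R₁,₀ t = witness m (m≤n+m 1 (F (2 + t))) (begin
  + (F (4 + t) + 2)                   ≡⟨ cong +_ (regroup (F (3 + t)) (F (2 + t))) ⟩
  + (F (3 + t) + 1 + (F (2 + t) + 1)) ≡⟨ cong (λ k → + (k + m)) (sym (a-F+1 t)) ⟩
  + (a m + m)                         ≡⟨ sym (f₁,₀ m) ⟩
  f 1 (+ 0) m                         ∎)
  where
  open ≡-Reasoning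
  m = F (2 + t) + 1
  regroup : ∀ x y → x + y + 2 ≡ x + 1 + (y + 1)
  regroup = solve-∀

theorem4p7 : (κ : ℕ → ℕ)
    → (∀ n → 1 ≤ n → InR 2 (+ 0) (+ n) → κ n ≡ a n + 1)
    → (∀ n → 1 ≤ n → InR 1 (+ 0) (+ n) → + κ n ≡ + a n - + 1)
    → (∀ n → 1 ≤ n → InR 1 (+ 1) (+ n) → + κ n ≡ (+ a n - + n) +ℤ + 1)
    → ∀ n → 1 ≤ n → iter κ n 3 ≡ F (n + 3) + 2
theorem4p7 κ κ-R₂,₀ κ-R₁,₀ _ (suc t) _ = trans (orbit t) (cong (λ k → F (suc k) + 2) (+-comm 3 t))
  where
  κ-step : ∀ t → κ (F (4 + t) + 2) ≡ F (5 + t) + 2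
  κ-step t = ℤₚ.+-injective (begin
    + κ (F (4 + t) + 2)          ≡⟨ κ-R₁,₀ _ (≤-trans (s≤s z≤n) (m≤n+m 2 _)) (F+2∈R₁,₀ t) ⟩
    + a (F (4 + t) + 2) - + 1    ≡⟨ cong (λ k → + k - + 1) (trans (a-F+2 t) (+-suc (F (5 + t)) 2)) ⟩
    + (F (5 + t) + 2)            ∎)
    where open ≡-Reasoning

  orbit : ∀ t → iter κ (suc t) 3 ≡ F (4 + t) + 2
  orbit zero    = κ-R₂,₀ 3 (s≤s z≤n) (witness 1 ≤-refl refl)
  orbit (suc t) = trans (cong κ (orbit t)) (κ-step t)
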